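{- Suppose that $X\subseteq(\omega)^\omega$ is unbounded under $\le_*$. Then $T_X$ is superperfect.
   Context: $(\omega)^\omega$ (resp. $(\omega)^{<\omega}$) is the set of strictly increasing functions from $\omega$ (resp. from some $n<\omega$) to $\omega$; $(\omega)^{<\omega}$ is a tree under the initial-segment relation $\sqsubseteq$. For $f,g\in(\omega)^\omega$, $f\le_* g$ iff there is $m$ with $f(n)\le g(n)$ for all $n\ge m$; a set is unbounded if no single $g$ $\le_*$-dominates all its elements. For $X\subseteq(\omega)^\omega$ and $s\in(\omega)^{<\omega}$ let $X_s=\{f\in X: s\sqsubseteq f\}$ and $T_X=\{s\in(\omega)^{<\omega}: X_s\text{ is unbounded under }\le_*\}$. For a subtree $T$ (a set closed under initial segments), a node $t\in T$ is $\infty$-splitting if for every $k$ there is $u\in T$ with $t\sqsubseteq u$ and $u(|t|)>k$; $T$ is superperfect if every $s\in T$ has an extension $t\in T$, $s\sqsubseteq t$, that is $\infty$-splitting in $T$. -}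

module Defs where

open import Data.Nat using (ℕ; _≤_; _<_)
open import Data.List using (List; length; lookup; _++_)
open import Data.Fin using (fromℕ<)
open import Data.Fin using (Fin; toℕ)
open import Data.Product using (Σ; _×_; ∃)
open import Relation.Binary.PropositionalEquality using (_≡_)
open import Relation.Nullary using (¬_)

-- elements of ω^ω are functions ℕ → ℕ; (ω)^ω = strictly increasing ones
StrictInc : (ℕ → ℕ) → Set
StrictInc f = ∀ n → f n < f (Data.Nat.suc n)

_≤*_ : (ℕ → ℕ) → (ℕ → ℕ) → Set
f ≤* g = ∃ λ m → ∀ n → m ≤ n → f n ≤ g n

Unbounded : ((ℕ → ℕ) → Set) → Set
Unbounded Y = ¬ (Σ (ℕ → ℕ) λ g → StrictInc g × (∀ f → Y f → f ≤* g))

_⊑f_ : List ℕ → (ℕ → ℕ) → Set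
s ⊑f f = ∀ (i : Fin (length s)) → lookup s i ≡ f (toℕ i)

_⊑_ : List ℕ → List ℕ → Set
s ⊑ t = ∃ λ r → s ++ r ≡ t

Restrict : ((ℕ → ℕ) → Set) → List ℕ → (ℕ → ℕ) → Set
Restrict X s f = X f × s ⊑f f

T[_] : ((ℕ → ℕ) → Set) → List ℕ → Set
T[ X ] s = Unbounded (Restrict X s)

InfSplitting : (List ℕ → Set) → List ℕ → Set
InfSplitting T t = ∀ (k : ℕ) → Σ (List ℕ) λ u → T u × t ⊑ u ×
  Σ (length t < length u) λ lt → k < lookup u (fromℕ< lt)

Superperfect : (List ℕ → Set) → Set
Superperfect T = ∀ s → T s → Σ (List ℕ) λ t → s ⊑ t × T t × InfSplitting T t

module Submission where

-- Let s ∈ T_X and suppose, towards a contradiction, that no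
-- extension t ⊒ s in T_X is ∞-splitting.  Classically we choose for every
-- node t a bound: a function dominating X_t when t ∉ T_X, and a number k
-- bounding u(|t|) over all u ∈ T_X extending t when t is not ∞-splitting.
-- A diagonal function G (module Diagonal) is built so that G n majorises the
-- bound of every node s ++ r with |r| ≤ n and entries of r below G (n - 1).
-- Every f ∈ X_s is then eventually below G: if some prefix of f leaves T_X,
-- f is dominated by that prefix's bound and hence by G; otherwise all
-- prefixes of f beyond s are non-∞-splitting nodes of T_X, and induction along
-- f gives f (|s| + d) ≤ G (|s| + d) for every d.  So G bounds X_s,
-- contradicting s ∈ T_X.

open import Defs
open import Data.Nat using (ℕ)
open import Data.Sum using (_⊎_)
open import Relation.Nullary using (¬_)

open import Data.Nat using (zero; suc; pred; _+_; _∸_; _≤_; _<_; z≤n; s≤s; z<s)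
open import Data.Nat.Properties
open import Data.Nat.Induction using (<-rec)
open import Data.List using (List; []; _∷_; _++_; _∷ʳ_; length; lookup; applyUpTo)
open import Data.List.Properties
  using (++-assoc; ++-identityʳ; length-++; length-applyUpTo; lookup-applyUpTo; applyUpTo-∷ʳ)
open import Data.List.Relation.Unary.All using (All; []; _∷_)
open import Data.List.Relation.Unary.All.Properties using (applyUpTo⁺₁; applyUpTo⁻)
open import Data.List.Extrema.Nat using (max; xs≤max; v≤max⁺)
open import Data.Fin using (fromℕ<)
import Data.Fin as Fin
open import Data.Fin.Properties using (toℕ-fromℕ<)
open import Data.Product using (Σ; _×_; _,_; proj₁; proj₂; ∃)
open import Data.Sum using (inj₁; inj₂)
open import Data.Empty using (⊥-elim)
open import Function using (_∘_)
open import Relation.Binary.PropositionalEquality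

⊑f⇒prefix : ∀ s f → s ⊑f f → s ≡ applyUpTo f (length s)
⊑f⇒prefix []      f h = refl
⊑f⇒prefix (x ∷ s) f h = cong₂ _∷_ (h Fin.zero) (⊑f⇒prefix s (f ∘ suc) (h ∘ Fin.suc))

applyUpTo-+ : ∀ {A : Set} (f : ℕ → A) a b →
              applyUpTo f (a + b) ≡ applyUpTo f a ++ applyUpTo (λ i → f (a + i)) b
applyUpTo-+ f zero    b = refl
applyUpTo-+ f (suc a) b = cong (f 0 ∷_) (applyUpTo-+ (f ∘ suc) a b)

≤max-upTo : ∀ a (h : ℕ → ℕ) {j B} → j ≤ B → h j ≤ max a (applyUpTo h (suc B))
≤max-upTo a h {B = B} j≤B = applyUpTo⁻ h (suc B) (xs≤max a (applyUpTo h (suc B))) (s≤s j≤B)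

-- branchBound φ B p d bounds φ at all extensions of p by at most d entries,
-- each at most B; there are finitely many such extensions.
branchBound : (List ℕ → ℕ) → ℕ → List ℕ → ℕ → ℕ
branchBound φ B p zero    = φ p
branchBound φ B p (suc d) = max (φ p) (applyUpTo (λ j → branchBound φ B (p ∷ʳ j) d) (suc B))

branchBound-root : ∀ φ B p d → φ p ≤ branchBound φ B p d
branchBound-root φ B p zero    = ≤-refl
branchBound-root φ B p (suc d) = v≤max⁺ (φ p) (applyUpTo (λ j → branchBound φ B (p ∷ʳ j) d) (suc B)) (inj₁ ≤-refl)

branchBound-≥ : ∀ φ B p d r → length r ≤ d → All (_≤ B) r → φ (p ++ r) ≤ branchBound φ B p d
branchBound-≥ φ B p d [] _ _ rewrite ++-identityʳ p = branchBound-root φ B p d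
branchBound-≥ φ B p (suc d) (j ∷ r) (s≤s |r|≤d) (j≤B ∷ r≤B) = begin
  φ (p ++ j ∷ r)                     ≡⟨ cong φ (sym (++-assoc p (j ∷ []) r)) ⟩
  φ ((p ∷ʳ j) ++ r)                  ≤⟨ branchBound-≥ φ B (p ∷ʳ j) d r |r|≤d r≤B ⟩
  branchBound φ B (p ∷ʳ j) d         ≤⟨ ≤max-upTo (φ p) (λ i → branchBound φ B (p ∷ʳ i) d) j≤B ⟩
  branchBound φ B p (suc d)          ∎
  where open ≤-Reasoning

-- Given a bound φ t n for every node t and a root s,
-- G n majorises φ (s ++ r) n whenever |r| ≤ n and all entries of r are at
-- most below n = G (n - 1); adding below n makes G strictly increasing.
module Diagonal (φ : List ℕ → ℕ → ℕ) (s : List ℕ) where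

  mutual
    G : ℕ → ℕ
    G n = below n + suc (branchBound (λ t → φ t n) (below n) s n)

    below : ℕ → ℕ
    below zero    = 0
    below (suc n) = G n

  G-inc : StrictInc G
  G-inc n = m<m+n (G n) z<s

  G-mono : ∀ {k n} → k ≤ n → G k ≤ G n
  G-mono {k} {n} k≤n with m≤n⇒m<n∨m≡n k≤n
  ... | inj₂ refl         = ≤-refl
  ... | inj₁ (s≤s k≤n-1) = ≤-trans (G-mono k≤n-1) (<⇒≤ (G-inc (pred n)))

  n≤G : ∀ n → n ≤ G n
  n≤G zero    = z≤n
  n≤G (suc n) = ≤-trans (s≤s (n≤G n)) (G-inc n)

  G≤below : ∀ {k n} → k < n → G k ≤ below n
  G≤below {n = suc n} (s≤s k≤n) = G-mono k≤n

  ≤below : ∀ {k n} → k < n → k ≤ below n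
  ≤below k<n = ≤-trans (n≤G _) (G≤below k<n)

  G-covers : ∀ n r → length r ≤ n → All (_≤ below n) r → φ (s ++ r) n ≤ G n
  G-covers n r |r|≤n r≤below =
    ≤-trans (branchBound-≥ (λ t → φ t n) (below n) s n r |r|≤n r≤below)
            (≤-trans (n≤1+n _) (m≤n+m _ (below n)))

Dominates : ((ℕ → ℕ) → Set) → (ℕ → ℕ) → Set
Dominates Y g = ∀ f → Y f → f ≤* g

NextBound : (List ℕ → Set) → List ℕ → ℕ → Set
NextBound T t k = ∀ u → T u → t ⊑ u → (lt : length t < length u) → lookup u (fromℕ< lt) ≤ k

module Classical (LEM : (P : Set) → P ⊎ ¬ P) where

  stable : {P : Set} → ¬ ¬ P → P
  stable {P} ¬¬p with LEM P
  ... | inj₁ p  = p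
  ... | inj₂ ¬p = ⊥-elim (¬¬p ¬p)

  ¬∀⇒∃¬ : {P : ℕ → Set} → ¬ (∀ k → P k) → ∃ λ k → ¬ P k
  ¬∀⇒∃¬ ¬all = stable λ ¬ex → ¬all λ k → stable λ ¬pk → ¬ex (k , ¬pk)

  chooseIf : {A : Set} {B : A → Set} {P : Set} → A → (P → Σ A B) → Σ A λ a → P → B a
  chooseIf {P = P} a₀ witness with LEM P
  ... | inj₁ p  = proj₁ (witness p) , λ _ → proj₂ (witness p)
  ... | inj₂ ¬p = a₀ , λ p → ⊥-elim (¬p p)

  bounded : ∀ {Y} → ¬ Unbounded Y → Σ (ℕ → ℕ) (Dominates Y)
  bounded ¬unb with stable ¬unb
  ... | g , _ , dom = g , dom

  nextBound : ∀ {T t} → ¬ InfSplitting T t → ∃ (NextBound T t)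
  nextBound ¬inf with ¬∀⇒∃¬ ¬inf
  ... | k , ¬large = k , λ u Tu t⊑u lt → ≮⇒≥ λ k<u → ¬large (u , Tu , t⊑u , lt , k<u)

module Superperfectness (LEM : (P : Set) → P ⊎ ¬ P) (X : (ℕ → ℕ) → Set) where
  open Classical LEM

  T : List ℕ → Set
  T = T[ X ]

  escapeChoice : ∀ t → Σ (ℕ → ℕ) λ g → ¬ T t → Dominates (Restrict X t) g
  escapeChoice t = chooseIf (λ _ → 0) bounded

  splitChoice : ∀ t → Σ ℕ λ k → ¬ InfSplitting T t → NextBound T t k
  splitChoice t = chooseIf 0 nextBound

  nodeBound : List ℕ → ℕ → ℕ
  nodeBound t n = proj₁ (escapeChoice t) n + proj₁ (splitChoice t)

  escape-≤ : ∀ t n → proj₁ (escapeChoice t) n ≤ nodeBound t n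
  escape-≤ t n = m≤m+n _ _

  split-≤ : ∀ t n → proj₁ (splitChoice t) ≤ nodeBound t n
  split-≤ t n = m≤n+m _ _

  module BelowNode (s : List ℕ) (noSplit : ∀ t → s ⊑ t → T t → ¬ InfSplitting T t) where
    open Diagonal nodeBound s public

    module Along (f : ℕ → ℕ) (Xf : X f) (s⊑f : s ⊑f f) where
      r : ℕ → List ℕ
      r d = applyUpTo (λ i → f (length s + i)) d

      node : ℕ → List ℕ
      node d = s ++ r d

      node-prefix : ∀ d → node d ≡ applyUpTo f (length s + d)
      node-prefix d = begin
        s ++ r d                                   ≡⟨ cong (_++ r d) (⊑f⇒prefix s f s⊑f) ⟩
        applyUpTo f (length s) ++ r d              ≡⟨ applyUpTo-+ f (length s) d ⟨
        applyUpTo f (length s + d)                 ∎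
        where open ≡-Reasoning

      node-⊑f : ∀ d → node d ⊑f f
      node-⊑f d = subst (_⊑f f) (sym (node-prefix d)) (lookup-applyUpTo f (length s + d))

      length-node : ∀ d → length (node d) ≡ length s + d
      length-node d = trans (length-++ s) (cong (length s +_) (length-applyUpTo _ d))

      node-covered : ∀ {d n} → d ≤ n → (∀ {i} → i < d → f (length s + i) ≤ below n) →
                     nodeBound (node d) n ≤ G n
      node-covered {d} {n} d≤n small =
        G-covers n (r d) (subst (_≤ n) (sym (length-applyUpTo _ d)) d≤n)
                 (applyUpTo⁺₁ _ d small)

      escaping : ∀ d → ¬ T (node d) → f ≤* G
      escaping d ¬T with proj₂ (escapeChoice (node d)) ¬T f (Xf , node-⊑f d)
      ... | n₀ , dom = n₀ + d + suc M , eventually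
        where
        M : ℕ
        M = max 0 (r d)
        eventually : ∀ n → n₀ + d + suc M ≤ n → f n ≤ G n
        eventually n N≤n = begin
          f n                                ≤⟨ dom n (≤-trans (≤-trans (m≤m+n n₀ d) (m≤m+n _ _)) N≤n) ⟩
          proj₁ (escapeChoice (node d)) n    ≤⟨ escape-≤ (node d) n ⟩
          nodeBound (node d) n               ≤⟨ node-covered d≤n (λ i<d → ≤-trans (entry≤M i<d) (≤below M<n)) ⟩
          G n                                ∎
          where
          open ≤-Reasoning
          d≤n : d ≤ n
          d≤n = ≤-trans (≤-trans (m≤n+m d n₀) (m≤m+n _ _)) N≤n
          M<n : M < n
          M<n = ≤-trans (m≤n+m (suc M) (n₀ + d)) N≤n
          entry≤M : ∀ {i} → i < d → f (length s + i) ≤ M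
          entry≤M = applyUpTo⁻ _ d (xs≤max 0 (r d))

      -- Case 2: every node lies in T.  Being extensions of s, none is
      -- ∞-splitting, so f's next value at each node is below the node bound.
      module Staying (allT : ∀ d → T (node d)) where
        node-step : ∀ d → node d ⊑ node (suc d)
        node-step d = f (length s + d) ∷ [] , (begin
          (s ++ r d) ++ f (length s + d) ∷ [] ≡⟨ ++-assoc s (r d) _ ⟩
          s ++ (r d ∷ʳ f (length s + d))      ≡⟨ cong (s ++_) (applyUpTo-∷ʳ _ d) ⟩
          s ++ r (suc d)                      ∎)
          where open ≡-Reasoning

        node-longer : ∀ d → length (node d) < length (node (suc d))
        node-longer d = subst₂ _<_ (sym (length-node d)) (sym (length-node (suc d)))
                               (+-monoʳ-< (length s) (n<1+n d))

        next-value : ∀ d → lookup (node (suc d)) (fromℕ< (node-longer d)) ≡ f (length s + d)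
        next-value d = trans (node-⊑f (suc d) (fromℕ< (node-longer d)))
                             (cong f (trans (toℕ-fromℕ< (node-longer d)) (length-node d)))

        value≤nodeBound : ∀ d → f (length s + d) ≤ nodeBound (node d) (length s + d)
        value≤nodeBound d = begin
          f (length s + d)                                 ≡⟨ next-value d ⟨
          lookup (node (suc d)) (fromℕ< (node-longer d))   ≤⟨ bounded-next ⟩
          proj₁ (splitChoice (node d))                     ≤⟨ split-≤ (node d) (length s + d) ⟩
          nodeBound (node d) (length s + d)                ∎
          where
          open ≤-Reasoning
          bounded-next : lookup (node (suc d)) (fromℕ< (node-longer d)) ≤ proj₁ (splitChoice (node d))
          bounded-next = proj₂ (splitChoice (node d)) (noSplit (node d) (r d , refl) (allT d))
                           (node (suc d)) (allT (suc d)) (node-step d) (node-longer d)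

        values≤G : ∀ d → f (length s + d) ≤ G (length s + d)
        values≤G = <-rec _ λ d ih →
          ≤-trans (value≤nodeBound d)
                  (node-covered (m≤n+m d (length s))
                     (λ i<d → ≤-trans (ih i<d) (G≤below (+-monoʳ-< (length s) i<d))))

        staying : f ≤* G
        staying = length s , λ n s≤n →
          subst (λ m → f m ≤ G m) (m+[n∸m]≡n s≤n) (values≤G (n ∸ length s))

      dominated : f ≤* G
      dominated with LEM (∀ d → T (node d))
      ... | inj₁ allT = Staying.staying allT
      ... | inj₂ ¬all with ¬∀⇒∃¬ ¬all
      ...   | d , ¬T = escaping d ¬T

  superperfect : Superperfect T
  superperfect s Ts with LEM (Σ (List ℕ) λ t → s ⊑ t × T t × InfSplitting T t)
  ... | inj₁ splittingExtension = splittingExtension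
  ... | inj₂ none = ⊥-elim (Ts (G , G-inc , λ f (Xf , s⊑f) → Along.dominated f Xf s⊑f))
    where
    noSplit : ∀ t → s ⊑ t → T t → ¬ InfSplitting T t
    noSplit t s⊑t Tt inf = none (t , s⊑t , Tt , inf)
    open BelowNode s noSplit

lemma4 : (LEM : (P : Set) → P ⊎ ¬ P) →
    (X : (ℕ → ℕ) → Set) → (∀ f → X f → StrictInc f) →
    Unbounded X → Superperfect T[ X ]
lemma4 LEM X _ _ = Superperfectness.superperfect LEM X
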